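{- Let $m \in \mathbb{Z}_{\ge 3}$ and let $H$ be an integer with $F_m \le H < F_{m+1}$. Then \[ A(H) = A(H - F_m) + A(H - F_{m-1}) - A(H - 2F_{m-1}) + 2^{m-3}. \]
   Context: The Fibonacci numbers are $F_1 = F_2 = 1$, $F_{m+1} = F_m + F_{m-1}$. For $n \in \mathbb{Z}_{\ge 0}$, $R(n)$ is the number of solutions to $x_1 + \cdots + x_s = n$ with $s \in \mathbb{Z}_{\ge 0}$ and $x_1 < \cdots < x_s$ Fibonacci numbers (partitions of $n$ into distinct Fibonacci numbers; $R(0)=1$). For $H \in \mathbb{Z}$, $A(H) = \sum_{n=0}^{H} R(n)$ (an empty sum, hence $0$, when $H < 0$). -}

module Defs where

open import Data.Nat using (ℕ; zero; suc; _+_; _≤?_; _≟_)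
open import Data.List using (List; []; _∷_; map; _++_; length; filter; upTo)
open import Data.Nat.ListAction using (sum)
open import Data.Integer as ℤ using (ℤ; +_; -[1+_])
open import Relation.Nullary.Decidable using (⌊_⌋)

F : ℕ → ℕ
F zero = zero
F (suc zero) = 1
F (suc (suc n)) = F (suc n) + F n

sublists : {A : Set} → List A → List (List A)
sublists [] = [] ∷ []
sublists (x ∷ xs) = let r = sublists xs in map (x ∷_) r ++ r

-- the distinct Fibonacci values ≤ n, in increasing order:
-- F 2 < F 3 < ... (F 1 = F 2 = 1 is the same value, so it is listed once)
-- F (k+2) ≥ k+1 > ... so indices 2 .. n+2 suffice to cover all values ≤ n
fibsUpTo : ℕ → List ℕ
fibsUpTo n = filter (λ v → v ≤? n) (map (λ i → F (suc (suc i))) (upTo (suc n)))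

-- R n : number of strictly increasing sequences x₁ < ... < x_s of Fibonacci
-- numbers with x₁ + ... + x_s = n. Every term of such a sequence is ≤ n, so
-- these are exactly the subsequences of fibsUpTo n with sum n.
R : ℕ → ℕ
R n = length (filter (λ xs → sum xs ≟ n) (sublists (fibsUpTo n)))

A' : ℕ → ℕ
A' zero = R zero
A' (suc h) = A' h + R (suc h)

-- A on integers; empty sum 0 for H < 0
A : ℤ → ℤ
A (+ h) = + A' h
A -[1+ _ ] = + 0

-- Let U k h count the sets of distinct values among F 2, …, F (1 + k) with sum at most h.
-- Splitting off the largest value gives U (k + 1) h = U k h + U k (h − F (2 + k)), with
-- U k = 0 at negative arguments; U k h = 2 ^ k as soon as h ≥ F (3 + k) − 2, the sum of
-- all these values; and A h = U k h whenever h < F (2 + k), since no larger Fibonacci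
-- number fits into h. For F m ≤ H < F (m + 1) this expands A H through U (m − 1) and
-- U (m − 2) into 2 ^ (m − 3) + U (m − 3) (H − F (m − 1)) + A (H − F m), and
-- A (H − F (m − 1)) into U (m − 3) (H − F (m − 1)) + A (H − 2 F (m − 1)); the common
-- term cancels.

module Submission where

open import Defs

module Counting where
  open import Data.Nat
  open import Data.Nat.Properties
  open import Algebra.Properties.CommutativeSemigroup +-commutativeSemigroup using (interchange)
  open import Data.List using (List; []; _∷_; [_]; map; _++_; length; filter; upTo)
  open import Data.List.Properties using (filter-accept; filter-reject; filter-++; length-++; map-++; applyUpTo-∷ʳ)
  open import Data.Nat.ListAction using (sum)
  open import Data.Nat.Tactic.RingSolver using (solve-∀)
  open import Function using (_∘_)
  open import Relation.Nullary using (Dec; yes; no)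
  open import Relation.Binary.PropositionalEquality hiding ([_])

  shift : ℕ → (ℕ → ℕ) → ℕ → ℕ
  shift zero    r n       = r n
  shift (suc x) r zero    = 0
  shift (suc x) r (suc n) = shift x r n

  shift-≥ : ∀ x r {n} → x ≤ n → shift x r n ≡ r (n ∸ x)
  shift-≥ zero    r z≤n     = refl
  shift-≥ (suc x) r (s≤s p) = shift-≥ x r p

  shift-< : ∀ x r {n} → n < x → shift x r n ≡ 0
  shift-< (suc x) r {zero}  _       = refl
  shift-< (suc x) r {suc n} (s≤s p) = shift-< x r p

  shift-cong : ∀ x {f g} n → f (n ∸ x) ≡ g (n ∸ x) → shift x f n ≡ shift x g n
  shift-cong zero    n       e = e
  shift-cong (suc x) zero    e = refl
  shift-cong (suc x) (suc n) e = shift-cong x n e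

  shift-+ : ∀ x f g n → shift x (λ k → f k + g k) n ≡ shift x f n + shift x g n
  shift-+ zero    f g n       = refl
  shift-+ (suc x) f g zero    = refl
  shift-+ (suc x) f g (suc n) = shift-+ x f g n

  shift-shift : ∀ x y r n → shift x (shift y r) n ≡ shift (x + y) r n
  shift-shift zero    y r n       = refl
  shift-shift (suc x) y r zero    = refl
  shift-shift (suc x) y r (suc n) = shift-shift x y r n

  shift-comm : ∀ x y r n → shift x (shift y r) n ≡ shift y (shift x r) n
  shift-comm x y r n = begin
    shift x (shift y r) n ≡⟨ shift-shift x y r n ⟩
    shift (x + y) r n     ≡⟨ cong (λ z → shift z r n) (+-comm x y) ⟩
    shift (y + x) r n     ≡⟨ shift-shift y x r n ⟨
    shift y (shift x r) n ∎
    where open ≡-Reasoning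

  shift-intro : ∀ x {φ r : ℕ → ℕ} → (∀ n → φ (x + n) ≡ r n) → (∀ n → n < x → φ n ≡ 0) →
                ∀ n → φ n ≡ shift x r n
  shift-intro zero    translate _      n       = translate n
  shift-intro (suc x) _         vanish zero    = vanish 0 z<s
  shift-intro (suc x) {φ} translate vanish (suc n) =
    shift-intro x {λ k → φ (suc k)} translate (λ k k<x → vanish (suc k) (s≤s k<x)) n

  sumCount : List (List ℕ) → ℕ → ℕ
  sumCount yss n = length (filter (λ ys → sum ys ≟ n) yss)

  sumCount-++ : ∀ xss yss n → sumCount (xss ++ yss) n ≡ sumCount xss n + sumCount yss n
  sumCount-++ xss yss n = begin
    length (filter P? (xss ++ yss))              ≡⟨ cong length (filter-++ P? xss yss) ⟩
    length (filter P? xss ++ filter P? yss)      ≡⟨ length-++ (filter P? xss) ⟩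
    sumCount xss n + sumCount yss n              ∎
    where
    open ≡-Reasoning
    P? : (ys : List ℕ) → Dec (sum ys ≡ n)
    P? ys = sum ys ≟ n

  sumCount-∷-≡ : ∀ ys yss {n} → sum ys ≡ n → sumCount (ys ∷ yss) n ≡ suc (sumCount yss n)
  sumCount-∷-≡ ys yss {n} s≡n = cong length (filter-accept (λ ys → sum ys ≟ n) {ys} {yss} s≡n)

  sumCount-∷-≢ : ∀ ys yss {n} → sum ys ≢ n → sumCount (ys ∷ yss) n ≡ sumCount yss n
  sumCount-∷-≢ ys yss {n} s≢n = cong length (filter-reject (λ ys → sum ys ≟ n) {ys} {yss} s≢n)

  sumCount-map-∷ : ∀ x yss n → sumCount (map (x ∷_) yss) (x + n) ≡ sumCount yss n
  sumCount-map-∷ x []         n = refl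
  sumCount-map-∷ x (ys ∷ yss) n with sum ys ≟ n
  ... | yes s≡n = begin
    sumCount ((x ∷ ys) ∷ map (x ∷_) yss) (x + n) ≡⟨ sumCount-∷-≡ (x ∷ ys) (map (x ∷_) yss) (cong (x +_) s≡n) ⟩
    suc (sumCount (map (x ∷_) yss) (x + n))      ≡⟨ cong suc (sumCount-map-∷ x yss n) ⟩
    suc (sumCount yss n)                         ≡⟨ sumCount-∷-≡ ys yss s≡n ⟨
    sumCount (ys ∷ yss) n                        ∎
    where open ≡-Reasoning
  ... | no s≢n = begin
    sumCount ((x ∷ ys) ∷ map (x ∷_) yss) (x + n) ≡⟨ sumCount-∷-≢ (x ∷ ys) (map (x ∷_) yss) (s≢n ∘ +-cancelˡ-≡ x _ _) ⟩
    sumCount (map (x ∷_) yss) (x + n)            ≡⟨ sumCount-map-∷ x yss n ⟩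
    sumCount yss n                               ≡⟨ sumCount-∷-≢ ys yss s≢n ⟨
    sumCount (ys ∷ yss) n                        ∎
    where open ≡-Reasoning

  sumCount-map-∷-< : ∀ x yss n → n < x → sumCount (map (x ∷_) yss) n ≡ 0
  sumCount-map-∷-< x []         n n<x = refl
  sumCount-map-∷-< x (ys ∷ yss) n n<x =
    trans (sumCount-∷-≢ (x ∷ ys) (map (x ∷_) yss) x+s≢n) (sumCount-map-∷-< x yss n n<x)
    where
    x+s≢n : x + sum ys ≢ n
    x+s≢n x+s≡n = <⇒≱ n<x (subst (x ≤_) x+s≡n (m≤m+n x (sum ys)))

  count : List ℕ → ℕ → ℕ
  count xs = sumCount (sublists xs)

  count-∷ : ∀ x xs n → count (x ∷ xs) n ≡ shift x (count xs) n + count xs n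
  count-∷ x xs n = begin
    sumCount (map (x ∷_) (sublists xs) ++ sublists xs) n          ≡⟨ sumCount-++ (map (x ∷_) (sublists xs)) (sublists xs) n ⟩
    sumCount (map (x ∷_) (sublists xs)) n + count xs n            ≡⟨ cong (_+ count xs n) (shift-intro x
                                                                        (sumCount-map-∷ x (sublists xs))
                                                                        (sumCount-map-∷-< x (sublists xs)) n) ⟩
    shift x (count xs) n + count xs n                             ∎
    where open ≡-Reasoning

  count-∷ʳ : ∀ xs y n → count (xs ++ [ y ]) n ≡ count xs n + shift y (count xs) n
  count-∷ʳ []       y n = trans (count-∷ y [] n) (+-comm (shift y (count []) n) (count [] n))
  count-∷ʳ (x ∷ xs) y n = begin
    count (x ∷ xs ++ [ y ]) n
      ≡⟨ count-∷ x (xs ++ [ y ]) n ⟩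
    shift x (count (xs ++ [ y ])) n + count (xs ++ [ y ]) n
      ≡⟨ cong₂ _+_ (shift-cong x n (count-∷ʳ xs y (n ∸ x))) (count-∷ʳ xs y n) ⟩
    shift x (λ k → c k + shift y c k) n + (c n + shift y c n)
      ≡⟨ cong (_+ (c n + shift y c n)) (shift-+ x c (shift y c) n) ⟩
    (shift x c n + shift x (shift y c) n) + (c n + shift y c n)
      ≡⟨ interchange (shift x c n) _ (c n) _ ⟩
    (shift x c n + c n) + (shift x (shift y c) n + shift y c n)
      ≡⟨ cong₂ _+_ (count-∷ x xs n) (cong (_+ shift y c n) (shift-comm y x c n)) ⟨
    count (x ∷ xs) n + (shift y (shift x c) n + shift y c n)
      ≡⟨ cong (count (x ∷ xs) n +_) (shift-+ y (shift x c) c n) ⟨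
    count (x ∷ xs) n + shift y (λ k → shift x c k + c k) n
      ≡⟨ cong (count (x ∷ xs) n +_) (shift-cong y n (count-∷ x xs (n ∸ y))) ⟨
    count (x ∷ xs) n + shift y (count (x ∷ xs)) n ∎
    where
    open ≡-Reasoning
    c : ℕ → ℕ
    c = count xs

  count-filter-≤ : ∀ b xs n → n ≤ b → count (filter (_≤? b) xs) n ≡ count xs n
  count-filter-≤ b []       n n≤b = refl
  count-filter-≤ b (x ∷ xs) n n≤b with x ≤? b
  ... | yes x≤b = begin
    count (filter (_≤? b) (x ∷ xs)) n
      ≡⟨ cong (λ ys → count ys n) (filter-accept (_≤? b) x≤b) ⟩
    count (x ∷ filter (_≤? b) xs) n
      ≡⟨ count-∷ x (filter (_≤? b) xs) n ⟩
    shift x (count (filter (_≤? b) xs)) n + count (filter (_≤? b) xs) n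
      ≡⟨ cong₂ _+_ (shift-cong x n (count-filter-≤ b xs (n ∸ x) (≤-trans (m∸n≤m n x) n≤b)))
                   (count-filter-≤ b xs n n≤b) ⟩
    shift x (count xs) n + count xs n
      ≡⟨ count-∷ x xs n ⟨
    count (x ∷ xs) n ∎
    where open ≡-Reasoning
  ... | no x≰b = begin
    count (filter (_≤? b) (x ∷ xs)) n
      ≡⟨ cong (λ ys → count ys n) (filter-reject (_≤? b) x≰b) ⟩
    count (filter (_≤? b) xs) n
      ≡⟨ count-filter-≤ b xs n n≤b ⟩
    count xs n
      ≡⟨ cong (_+ count xs n) (shift-< x (count xs) n<x) ⟨
    shift x (count xs) n + count xs n
      ≡⟨ count-∷ x xs n ⟨
    count (x ∷ xs) n ∎
    where
    open ≡-Reasoning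
    n<x : n < x
    n<x = ≤-<-trans n≤b (≰⇒> x≰b)

  prefixSum : (ℕ → ℕ) → ℕ → ℕ
  prefixSum f zero    = f zero
  prefixSum f (suc h) = prefixSum f h + f (suc h)

  prefixSum-cong : ∀ {f g} → (∀ n → f n ≡ g n) → ∀ h → prefixSum f h ≡ prefixSum g h
  prefixSum-cong f≗g zero    = f≗g zero
  prefixSum-cong f≗g (suc h) = cong₂ _+_ (prefixSum-cong f≗g h) (f≗g (suc h))

  prefixSum-+ : ∀ f g h → prefixSum (λ n → f n + g n) h ≡ prefixSum f h + prefixSum g h
  prefixSum-+ f g zero    = refl
  prefixSum-+ f g (suc h) = trans (cong (_+ (f (suc h) + g (suc h))) (prefixSum-+ f g h))
                                  (interchange (prefixSum f h) _ _ _)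

  shift-prefixSum-zero : ∀ x f → shift x (prefixSum f) 0 ≡ shift x f 0
  shift-prefixSum-zero zero    f = refl
  shift-prefixSum-zero (suc x) f = refl

  shift-prefixSum-suc : ∀ x f h → shift x (prefixSum f) (suc h) ≡ shift x (prefixSum f) h + shift x f (suc h)
  shift-prefixSum-suc zero    f h       = refl
  shift-prefixSum-suc (suc x) f zero    = shift-prefixSum-zero x f
  shift-prefixSum-suc (suc x) f (suc h) = shift-prefixSum-suc x f h

  prefixSum-shift : ∀ x f h → prefixSum (shift x f) h ≡ shift x (prefixSum f) h
  prefixSum-shift x f zero    = sym (shift-prefixSum-zero x f)
  prefixSum-shift x f (suc h) = trans (cong (_+ shift x f (suc h)) (prefixSum-shift x f h))
                                      (sym (shift-prefixSum-suc x f h))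

  F-mono-suc : ∀ n → F n ≤ F (suc n)
  F-mono-suc zero    = z≤n
  F-mono-suc (suc n) = m≤m+n (F (suc n)) (F n)

  F-mono : ∀ {m n} → m ≤ n → F m ≤ F n
  F-mono m≤n = F-mono-≤′ (≤⇒≤′ m≤n)
    where
    F-mono-≤′ : ∀ {m n} → m ≤′ n → F m ≤ F n
    F-mono-≤′ ≤′-refl                    = ≤-refl
    F-mono-≤′ {n = suc n} (≤′-step m≤′n) = ≤-trans (F-mono-≤′ m≤′n) (F-mono-suc n)

  F-pos : ∀ n → 0 < F (suc n)
  F-pos n = F-mono {1} {suc n} (s≤s z≤n)

  n<F[2+n] : ∀ n → n < F (2 + n)
  n<F[2+n] zero    = z<s
  n<F[2+n] (suc n) = subst (_≤ F (3 + n)) (+-comm (suc n) 1) (+-mono-≤ (n<F[2+n] n) (F-pos n))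

  fibList : ℕ → List ℕ
  fibList k = map (λ i → F (2 + i)) (upTo k)

  fibList-suc : ∀ k → fibList (suc k) ≡ fibList k ++ [ F (2 + k) ]
  fibList-suc k = begin
    map (λ i → F (2 + i)) (upTo (suc k))       ≡⟨ cong (map (λ i → F (2 + i))) (applyUpTo-∷ʳ (λ i → i) k) ⟨
    map (λ i → F (2 + i)) (upTo k ++ [ k ])    ≡⟨ map-++ (λ i → F (2 + i)) (upTo k) [ k ] ⟩
    fibList k ++ [ F (2 + k) ]                 ∎
    where open ≡-Reasoning

  fibCount : ℕ → ℕ → ℕ
  fibCount k = count (fibList k)

  fibCount-suc : ∀ k n → fibCount (suc k) n ≡ fibCount k n + shift (F (2 + k)) (fibCount k) n
  fibCount-suc k n = trans (cong (λ xs → count xs n) (fibList-suc k)) (count-∷ʳ (fibList k) (F (2 + k)) n)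

  fibCount-stable : ∀ d k n → n < F (2 + k) → fibCount (d + k) n ≡ fibCount k n
  fibCount-stable zero    k n n<F = refl
  fibCount-stable (suc d) k n n<F = begin
    fibCount (suc (d + k)) n                                          ≡⟨ fibCount-suc (d + k) n ⟩
    fibCount (d + k) n + shift (F (2 + d + k)) (fibCount (d + k)) n   ≡⟨ cong (fibCount (d + k) n +_) (shift-< _ _ n<F′) ⟩
    fibCount (d + k) n + 0                                            ≡⟨ +-identityʳ _ ⟩
    fibCount (d + k) n                                                ≡⟨ fibCount-stable d k n n<F ⟩
    fibCount k n                                                      ∎
    where
    open ≡-Reasoning
    n<F′ : n < F (2 + d + k)
    n<F′ = <-≤-trans n<F (F-mono (s≤s (s≤s (m≤n+m k d))))

  R≡fibCount : ∀ k n → n < F (2 + k) → R n ≡ fibCount k n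
  R≡fibCount k n n<F = begin
    R n                      ≡⟨ count-filter-≤ n (fibList (suc n)) n ≤-refl ⟩
    fibCount (suc n) n       ≡⟨ fibCount-stable k (suc n) n (<-trans (n<1+n n) (n<F[2+n] (suc n))) ⟨
    fibCount (k + suc n) n   ≡⟨ cong (λ l → fibCount l n) (+-comm k (suc n)) ⟩
    fibCount (suc n + k) n   ≡⟨ fibCount-stable (suc n) k n n<F ⟩
    fibCount k n             ∎
    where open ≡-Reasoning

  fibCountUpTo : ℕ → ℕ → ℕ
  fibCountUpTo k = prefixSum (fibCount k)

  fibCountUpTo-suc : ∀ k h →
    fibCountUpTo (suc k) h ≡ fibCountUpTo k h + shift (F (2 + k)) (fibCountUpTo k) h
  fibCountUpTo-suc k h = begin
    prefixSum (fibCount (suc k)) h                              ≡⟨ prefixSum-cong (fibCount-suc k) h ⟩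
    prefixSum (λ n → fibCount k n + shift a (fibCount k) n) h   ≡⟨ prefixSum-+ (fibCount k) (shift a (fibCount k)) h ⟩
    fibCountUpTo k h + prefixSum (shift a (fibCount k)) h       ≡⟨ cong (fibCountUpTo k h +_) (prefixSum-shift a (fibCount k) h) ⟩
    fibCountUpTo k h + shift a (fibCountUpTo k) h               ∎
    where
    open ≡-Reasoning
    a : ℕ
    a = F (2 + k)

  A'≡fibCountUpTo : ∀ k h → h < F (2 + k) → A' h ≡ fibCountUpTo k h
  A'≡fibCountUpTo k zero    h<F = R≡fibCount k zero h<F
  A'≡fibCountUpTo k (suc h) h<F =
    cong₂ _+_ (A'≡fibCountUpTo k h (<-trans (n<1+n h) h<F)) (R≡fibCount k (suc h) h<F)

  fibCountUpTo-zero : ∀ h → fibCountUpTo 0 h ≡ 1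
  fibCountUpTo-zero zero    = refl
  fibCountUpTo-zero (suc h) = cong (_+ 0) (fibCountUpTo-zero h)

  -- F 2 + ⋯ + F (1 + k) = F (3 + k) ∸ 2 is the sum of the whole of fibList k.
  fibCountUpTo-full : ∀ k h → F (3 + k) ≤ h + 2 → fibCountUpTo k h ≡ 2 ^ k
  fibCountUpTo-full zero    h _      = fibCountUpTo-zero h
  fibCountUpTo-full (suc k) h b+a≤h+2 = begin
    fibCountUpTo (suc k) h                         ≡⟨ fibCountUpTo-suc k h ⟩
    fibCountUpTo k h + shift a (fibCountUpTo k) h  ≡⟨ cong₂ _+_ (fibCountUpTo-full k h b≤h+2) (shift-≥ a _ a≤h) ⟩
    2 ^ k + fibCountUpTo k (h ∸ a)                 ≡⟨ cong (2 ^ k +_) (fibCountUpTo-full k (h ∸ a) b≤h∸a+2) ⟩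
    2 ^ k + 2 ^ k                                  ≡⟨ cong (2 ^ k +_) (+-identityʳ (2 ^ k)) ⟨
    2 ^ suc k                                      ∎
    where
    open ≡-Reasoning
    a b : ℕ
    a = F (2 + k)
    b = F (3 + k)
    b≤h+2 : b ≤ h + 2
    b≤h+2 = ≤-trans (m≤m+n b a) b+a≤h+2
    a≤h : a ≤ h
    a≤h = +-cancelʳ-≤ 2 a h
            (≤-trans (+-monoʳ-≤ a 2≤b) (subst (_≤ h + 2) (+-comm b a) b+a≤h+2))
      where
      2≤b : 2 ≤ b
      2≤b = ≤-trans (s≤s (s≤s z≤n)) (n<F[2+n] (suc k))
    b≤h∸a+2 : b ≤ h ∸ a + 2
    b≤h∸a+2 = subst₂ _≤_ (m+n∸n≡m b a) (+-∸-comm 2 a≤h) (∸-monoˡ-≤ a b+a≤h+2)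

  A'-recurrence : ∀ j h → F (3 + j) ≤ h → h < F (4 + j) →
    A' h + shift (F (2 + j) + F (2 + j)) A' h ≡ shift (F (3 + j)) A' h + shift (F (2 + j)) A' h + 2 ^ j
  A'-recurrence j h Fm≤h h<F = begin
    A' h + shift (f + f) A' h                          ≡⟨ cong₂ _+_ A'-split shift-twice ⟩
    2 ^ j + U j g + shift Fm A' h + shift f A' g       ≡⟨ rearrange (2 ^ j) (U j g) (shift Fm A' h) (shift f A' g) ⟩
    shift Fm A' h + (U j g + shift f A' g) + 2 ^ j     ≡⟨ cong (λ z → shift Fm A' h + z + 2 ^ j) shifted-A'-split ⟨
    shift Fm A' h + shift f A' h + 2 ^ j               ∎
    where
    open ≡-Reasoning
    U : ℕ → ℕ → ℕ
    U = fibCountUpTo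
    f Fm g : ℕ
    f = F (2 + j)
    Fm = F (3 + j)
    g = h ∸ f

    rearrange : ∀ a b c d → a + b + c + d ≡ c + (b + d) + a
    rearrange = solve-∀

    f≤h : f ≤ h
    f≤h = ≤-trans (F-mono-suc (2 + j)) Fm≤h

    h∸Fm<Fm : h ∸ Fm < Fm
    h∸Fm<Fm = <-≤-trans (m<n+o⇒m∸n<o h Fm ⦃ >-nonZero (F-pos (1 + j)) ⦄ h<F) (F-mono-suc (2 + j))

    g<Fm : g < Fm
    g<Fm = m<n+o⇒m∸n<o h f ⦃ >-nonZero (F-pos (2 + j)) ⦄ (subst (h <_) (+-comm Fm f) h<F)

    g∸f<f : g ∸ f < f
    g∸f<f = <-≤-trans (m<n+o⇒m∸n<o g f ⦃ >-nonZero (F-pos j) ⦄ g<Fm) (F-mono-suc (1 + j))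

    A'-split : A' h ≡ 2 ^ j + U j g + shift Fm A' h
    A'-split = begin
      A' h                                          ≡⟨ A'≡fibCountUpTo (2 + j) h h<F ⟩
      U (2 + j) h                                   ≡⟨ fibCountUpTo-suc (1 + j) h ⟩
      U (1 + j) h + shift Fm (U (1 + j)) h          ≡⟨ cong₂ _+_ (fibCountUpTo-suc j h)
                                                      (shift-cong Fm h (sym (A'≡fibCountUpTo (1 + j) (h ∸ Fm) h∸Fm<Fm))) ⟩
      U j h + shift f (U j) h + shift Fm A' h       ≡⟨ cong (_+ shift Fm A' h)
                                                      (cong₂ _+_ (fibCountUpTo-full j h (≤-trans Fm≤h (m≤m+n h 2)))
                                                                 (shift-≥ f (U j) f≤h)) ⟩
      2 ^ j + U j g + shift Fm A' h                 ∎

    shift-twice : shift (f + f) A' h ≡ shift f A' g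
    shift-twice = trans (sym (shift-shift f f A' h)) (shift-≥ f (shift f A') f≤h)

    shifted-A'-split : shift f A' h ≡ U j g + shift f A' g
    shifted-A'-split = begin
      shift f A' h              ≡⟨ shift-≥ f A' f≤h ⟩
      A' g                      ≡⟨ A'≡fibCountUpTo (1 + j) g g<Fm ⟩
      U (1 + j) g               ≡⟨ fibCountUpTo-suc j g ⟩
      U j g + shift f (U j) g   ≡⟨ cong (U j g +_) (shift-cong f g (A'≡fibCountUpTo j (g ∸ f) g∸f<f)) ⟨
      U j g + shift f A' g      ∎

open Counting using (shift; A'-recurrence)
open import Data.Nat using (ℕ; zero; suc; _^_; _∸_)
open import Data.Nat as N using ()
open import Data.Nat.Properties using (+-identityʳ)
open import Data.Integer using (ℤ; +_; _+_; _-_; _*_; _≤_; _<_; _⊖_; +≤+; +<+)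
open import Data.Integer.Properties using ([+m]-[+n]≡m⊖n; [1+m]⊖[1+n]≡m⊖n; ⊖-≥; ⊖-<; pos-+; pos-*)
open import Data.Integer.Tactic.RingSolver using (solve-∀)
open import Relation.Binary.PropositionalEquality using (_≡_; cong; cong₂; sym; trans; module ≡-Reasoning)

A-⊖ : ∀ n x → A (n ⊖ x) ≡ + shift x A' n
A-⊖ n       zero    = cong A (⊖-≥ {n} N.z≤n)
A-⊖ zero    (suc x) = cong A (⊖-< {0} {suc x} N.z<s)
A-⊖ (suc n) (suc x) = trans (cong A ([1+m]⊖[1+n]≡m⊖n n x)) (A-⊖ n x)

A-minus : ∀ n x → A (+ n - + x) ≡ + shift x A' n
A-minus n x = trans (cong A ([+m]-[+n]≡m⊖n n x)) (A-⊖ n x)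

move-subtrahend : ∀ {a b c d e} → a + d ≡ b + c + e → a ≡ b + c - d + e
move-subtrahend {a} {b} {c} {d} {e} a+d≡b+c+e = begin
  a              ≡⟨ add-subtract a d ⟩
  a + d - d      ≡⟨ cong (_- d) a+d≡b+c+e ⟩
  b + c + e - d  ≡⟨ exchange b c d e ⟩
  b + c - d + e  ∎
  where
  open ≡-Reasoning
  add-subtract : ∀ a d → a ≡ a + d - d
  add-subtract = solve-∀
  exchange : ∀ b c d e → b + c + e - d ≡ b + c - d + e
  exchange = solve-∀

pos-balance : ∀ {a b c d e} → a N.+ d ≡ b N.+ c N.+ e → + a ≡ + b + + c - + d + + e
pos-balance {a} {b} {c} {d} {e} eq = move-subtrahend {+ a} {+ b} {+ c} {+ d} {+ e} (begin
  + a + + d          ≡⟨ pos-+ a d ⟨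
  + (a N.+ d)        ≡⟨ cong +_ eq ⟩
  + (b N.+ c N.+ e)  ≡⟨ trans (pos-+ (b N.+ c) e) (cong (_+ + e) (pos-+ b c)) ⟩
  + b + + c + + e    ∎)
  where open ≡-Reasoning

lemma3p1 : (m : ℕ) → 3 N.≤ m → (H : ℤ) → + F m ≤ H → H < + F (suc m) →
    A H ≡ A (H - + F m) + A (H - + F (m ∸ 1)) - A (H - + 2 * + F (m ∸ 1)) + + (2 ^ (m ∸ 3))
lemma3p1 (suc (suc (suc j))) (N.s≤s (N.s≤s (N.s≤s N.z≤n))) (+ h) (+≤+ Fm≤h) (+<+ h<F) = begin
  + A' h
    ≡⟨ pos-balance {b = shift Fm A' h} {c = shift f A' h} (A'-recurrence j h Fm≤h h<F) ⟩
  + shift Fm A' h + + shift f A' h - + shift (f N.+ f) A' h + + (2 ^ j)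
    ≡⟨ cong₂ (λ u v → u - v + + (2 ^ j)) (cong₂ _+_ (A-minus h Fm) (A-minus h f))
             (trans (cong (λ z → A (+ h - z)) twice-f) (A-minus h (f N.+ f))) ⟨
  A (+ h - + Fm) + A (+ h - + f) - A (+ h - + 2 * + f) + + (2 ^ j)
    ∎
  where
  open ≡-Reasoning
  f Fm : ℕ
  f = F (2 N.+ j)
  Fm = F (3 N.+ j)
  twice-f : + 2 * + f ≡ + (f N.+ f)
  twice-f = trans (sym (pos-* 2 f)) (cong (λ z → + (f N.+ z)) (+-identityʳ f))
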